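{- For all $n\ge1$, $|SI_n(321)|=|SI_n(3\bar{2}1)|$.
   Context: $B_n$ is the set of signed permutations of $[n]$, written as words $\pi=\pi_1\cdots\pi_n$ in which each of $1,\dots,n$ appears exactly once, possibly barred (negative, written $\bar{a}$). A signed permutation $\pi\in B_n$ contains $\tau\in B_k$ if there are indices $i_1<\dots<i_k$ such that for all $a,b$: $|\pi_{i_a}|<|\pi_{i_b}|$ iff $|\tau_a|<|\tau_b|$, and $\pi_{i_a}$ is positive iff $\tau_a$ is positive; otherwise $\pi$ avoids $\tau$. $SI_n$ is the set of signed involutions in $B_n$ (signed permutations $\pi$, viewed as bijections of $\{\pm1,\dots,\pm n\}$ with $\pi(-i)=-\pi(i)$, satisfying $\pi\circ\pi=\mathrm{id}$), and $SI_n(\tau)$ is the set of those avoiding $\tau$. -}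

module Defs where

open import Data.Nat using (ℕ; suc)
open import Data.Fin using (Fin; zero; suc; _<_)
open import Data.Vec using (Vec; lookup; _∷_; [])
open import Data.Product using (_×_; _,_; proj₁; proj₂; ∃)
open import Relation.Binary.PropositionalEquality using (_≡_; _≢_)
open import Relation.Nullary using (¬_)
open import Function.Bundles using (_⇔_)

-- A signed letter: a sign together with an absolute value.
-- The absolute value a ∈ {1,…,n} is encoded as the element (a-1) of Fin n.
data Sign : Set where
  pos neg : Sign

Letter : ℕ → Set
Letter n = Sign × Fin n

sign : ∀ {n} → Letter n → Sign
sign = proj₁

∣_∣ : ∀ {n} → Letter n → Fin n
∣ x ∣ = proj₂ x

Word : ℕ → Set
Word n = Vec (Letter n) n

IsSignedPerm : ∀ {n} → Word n → Set
IsSignedPerm {n} w = ∀ (i j : Fin n) → i ≢ j → ∣ lookup w i ∣ ≢ ∣ lookup w j ∣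

-- Involution: viewing w as the map i ↦ πᵢ on {±1,…,±n} with π(-i) = -π(i),
-- π(π(i)) = i for every i.  Writing πᵢ = ε·a, π(π(i)) = ε·π(a), so the
-- condition is: |π_a| = i and π_a has the same sign as πᵢ.
IsInvolution : ∀ {n} → Word n → Set
IsInvolution {n} w = ∀ (i : Fin n) →
  (∣ lookup w ∣ lookup w i ∣ ∣ ≡ i) × (sign (lookup w ∣ lookup w i ∣) ≡ sign (lookup w i))

Contains : ∀ {n k} → Word n → Word k → Set
Contains {n} {k} π τ =
  ∃ λ (ι : Fin k → Fin n) →
      (∀ (a b : Fin k) → a < b → ι a < ι b)
    × (∀ (a b : Fin k) →
          ((∣ lookup π (ι a) ∣ < ∣ lookup π (ι b) ∣) ⇔ (∣ lookup τ a ∣ < ∣ lookup τ b ∣))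
        × (sign (lookup π (ι a)) ≡ sign (lookup τ a)))

Avoids : ∀ {n k} → Word n → Word k → Set
Avoids π τ = ¬ Contains π τ

-- SI_n(τ): signed involutions of [n] avoiding τ.  Proof fields are
-- irrelevant, so two elements are equal iff their words are equal.
record SI (n : ℕ) {k : ℕ} (τ : Word k) : Set where
  constructor mkSI
  field
    word : Word n
    .signedPerm : IsSignedPerm word
    .involution : IsInvolution word
    .avoids     : Avoids word τ

p321 : Word 3
p321 = (pos , suc (suc zero)) ∷ (pos , suc zero) ∷ (pos , zero) ∷ []

p3b21 : Word 3
p3b21 = (pos , suc (suc zero)) ∷ (neg , suc zero) ∷ (pos , zero) ∷ []

{-# OPTIONS --safe #-}
module Submission where

-- Call j a middle of π if π_j is the middle entry of an occurrence of 321 in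
-- absolute values whose outer entries are positive: π contains 321 iff some middle
-- is positive, and contains 3 2̄ 1 iff some middle is negative.  Flipping the signs
-- of all middles does not change the set of middles: an outer entry that is
-- positive after the flip but was not before was a middle, and its own left (right)
-- outer entry, which lies north-west (south-east) of it, can take its place;
-- conversely, following left (right) outer entries from a positive entry ends at a
-- positive non-middle north-west (south-east) of it, whose sign the flip keeps.  So
-- the flip is an involution exchanging the two avoidance classes, and it preserves
-- signed involutions because an involution maps its middles to middles.

open import Defs
open import Data.Bool using (if_then_else_)
open import Data.Nat using (ℕ; _≥_; z≤n; s≤s)
open import Data.Nat.Properties using (<⇒≤; ≤-<-trans; <-≤-trans)
open import Data.Fin using (Fin; zero; suc; _<_; _>_; _≤_; #_)
open import Data.Fin.Induction using (<-wellFounded)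
open import Data.Fin.Properties using (any?; _<?_; ≤-refl; ≤-trans; <-trans; <-asym; <-irrefl; <-cmp)
open import Data.Vec using (lookup; tabulate; _∷_; [])
open import Data.Vec.Properties using (lookup∘tabulate; tabulate-cong; tabulate∘lookup)
open import Data.Product using (_×_; _,_; proj₁; proj₂; ∃; ∃₂)
open import Data.Empty using (⊥-elim)
open import Function using (_∘_; flip; case_of_)
open import Function.Bundles using (_↔_; _⇔_; mk⇔; mk↔ₛ′; Equivalence)
import Function.Properties.Equivalence as ⇔
open import Induction.WellFounded using (Acc; acc)
open import Relation.Binary using (Rel; Transitive; tri<; tri≈; tri>)
open import Relation.Binary.PropositionalEquality
  using (_≡_; _≗_; refl; sym; trans; cong; cong₂; subst; subst₂; module ≡-Reasoning)
open import Relation.Nullary using (¬_; Dec; yes; no; does)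
open import Relation.Nullary.Decidable using (_×-dec_)

open ≡-Reasoning

flipSign : Sign → Sign
flipSign pos = neg
flipSign neg = pos

flipSign-involutive : ∀ s → flipSign (flipSign s) ≡ s
flipSign-involutive pos = refl
flipSign-involutive neg = refl

flipSign-injective : ∀ {s t} → flipSign s ≡ flipSign t → s ≡ t
flipSign-injective {pos} {pos} _ = refl
flipSign-injective {neg} {neg} _ = refl

_≟_ : (s t : Sign) → Dec (s ≡ t)
pos ≟ pos = yes refl
neg ≟ neg = yes refl
pos ≟ neg = no λ ()
neg ≟ pos = no λ ()

monotone-Fin3 : ∀ {a ℓ} {A : Set a} {R : Rel A ℓ} → Transitive R → (f : Fin 3 → A) →
                R (f zero) (f (suc zero)) → R (f (suc zero)) (f (suc (suc zero))) →
                ∀ x y → x < y → R (f x) (f y)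
monotone-Fin3 _       _ r₀₁ _   zero       (suc zero)       _ = r₀₁
monotone-Fin3 R-trans _ r₀₁ r₁₂ zero       (suc (suc zero)) _ = R-trans r₀₁ r₁₂
monotone-Fin3 _       _ _   r₁₂ (suc zero) (suc (suc zero)) _ = r₁₂
monotone-Fin3 _ _ _ _ zero zero ()
monotone-Fin3 _ _ _ _ (suc _) zero ()
monotone-Fin3 _ _ _ _ (suc zero) (suc zero) (s≤s ())
monotone-Fin3 _ _ _ _ (suc (suc zero)) (suc zero) (s≤s ())
monotone-Fin3 _ _ _ _ (suc (suc zero)) (suc (suc zero)) (s≤s (s≤s ()))

strictlyDecreasing⇒<⇔> : ∀ {m n} {f : Fin m → Fin n} → (∀ x y → x < y → f x > f y) →
                         ∀ x y → f x < f y ⇔ y < x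
strictlyDecreasing⇒<⇔> {f = f} decreasing x y = mk⇔ reflect (decreasing y x)
  where
  reflect : f x < f y → y < x
  reflect fx<fy with <-cmp x y
  ... | tri< x<y _ _ = ⊥-elim (<-asym fx<fy (decreasing x y x<y))
  ... | tri≈ _ refl _ = ⊥-elim (<-irrefl refl fx<fy)
  ... | tri> _ _ y<x = y<x

module _ {n : ℕ} (σ : Fin n → Fin n) where

  Is321 : Fin n → Fin n → Fin n → Set
  Is321 i j k = i < j × j < k × σ j < σ i × σ k < σ j

  NorthWest : Fin n → Fin n → Set
  NorthWest a b = a ≤ b × σ b ≤ σ a

  NorthWest-refl : ∀ {a} → NorthWest a a
  NorthWest-refl = ≤-refl , ≤-refl

  NorthWest-trans : ∀ {a b c} → NorthWest a b → NorthWest b c → NorthWest a c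
  NorthWest-trans (a≤b , σb≤σa) (b≤c , σc≤σb) = ≤-trans a≤b b≤c , ≤-trans σc≤σb σb≤σa

  Is321-widen : ∀ {i i′ j k k′} → NorthWest i′ i → NorthWest k k′ → Is321 i j k → Is321 i′ j k′
  Is321-widen (i′≤i , σi≤σi′) (k≤k′ , σk′≤σk) (i<j , j<k , σj<σi , σk<σj) =
    ≤-<-trans i′≤i i<j , <-≤-trans j<k k≤k′ , <-≤-trans σj<σi σi≤σi′ , ≤-<-trans σk′≤σk σk<σj

  Middle : (Fin n → Sign) → Fin n → Set
  Middle p j = ∃₂ λ i k → Is321 i j k × p i ≡ pos × p k ≡ pos

  middle? : ∀ p j → Dec (Middle p j)
  middle? p j = any? λ i → any? λ k →
    ((i <? j) ×-dec (j <? k) ×-dec (σ j <? σ i) ×-dec (σ k <? σ j)) ×-dec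
    (p i ≟ pos) ×-dec (p k ≟ pos)

  flipMiddles : (Fin n → Sign) → Fin n → Sign
  flipMiddles p j = if does (middle? p j) then flipSign (p j) else p j

  flipMiddles-middle : ∀ {p j} → Middle p j → flipMiddles p j ≡ flipSign (p j)
  flipMiddles-middle {p} {j} m with middle? p j
  ... | yes _ = refl
  ... | no ¬m = ⊥-elim (¬m m)

  flipMiddles-nonMiddle : ∀ {p j} → ¬ Middle p j → flipMiddles p j ≡ p j
  flipMiddles-nonMiddle {p} {j} ¬m with middle? p j
  ... | yes m = ⊥-elim (¬m m)
  ... | no _ = refl

  Is321-involution : (∀ x → σ (σ x) ≡ x) → ∀ {i j k} → Is321 i j k → Is321 (σ k) (σ j) (σ i)
  Is321-involution σ-involutive {i} {j} {k} (i<j , j<k , σj<σi , σk<σj) =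
    σk<σj , σj<σi ,
    subst₂ _<_ (sym (σ-involutive j)) (sym (σ-involutive k)) j<k ,
    subst₂ _<_ (sym (σ-involutive i)) (sym (σ-involutive j)) i<j

  module _ {p : Fin n → Sign} where

    positive⇒nonMiddle-NorthWest : ∀ {i} → p i ≡ pos →
                                   ∃ λ i* → NorthWest i* i × p i* ≡ pos × ¬ Middle p i*
    positive⇒nonMiddle-NorthWest {i} = go i (<-wellFounded i)
      where
      go : ∀ i → Acc _<_ i → p i ≡ pos → ∃ λ i* → NorthWest i* i × p i* ≡ pos × ¬ Middle p i*
      go i (acc rs) pi with middle? p i
      ... | no ¬m = i , NorthWest-refl , pi , ¬m
      ... | yes (i′ , _ , (i′<i , _ , σi<σi′ , _) , pi′ , _) with go i′ (rs i′<i) pi′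
      ... | i* , i*↖i′ , pi* , ¬m* = i* , NorthWest-trans i*↖i′ (<⇒≤ i′<i , <⇒≤ σi<σi′) , pi* , ¬m*

    positive⇒nonMiddle-SouthEast : ∀ {k} → p k ≡ pos →
                                   ∃ λ k* → NorthWest k k* × p k* ≡ pos × ¬ Middle p k*
    positive⇒nonMiddle-SouthEast {k} = go k (<-wellFounded (σ k))
      where
      go : ∀ k → Acc _<_ (σ k) → p k ≡ pos → ∃ λ k* → NorthWest k k* × p k* ≡ pos × ¬ Middle p k*
      go k (acc rs) pk with middle? p k
      ... | no ¬m = k , NorthWest-refl , pk , ¬m
      ... | yes (_ , k′ , (_ , k<k′ , _ , σk′<σk) , _ , pk′) with go k′ (rs σk′<σk) pk′
      ... | k* , k′↖k* , pk* , ¬m* = k* , NorthWest-trans (<⇒≤ k<k′ , <⇒≤ σk′<σk) k′↖k* , pk* , ¬m*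

    flipMiddles-preservesMiddle : ∀ {j} → Middle p j → Middle (flipMiddles p) j
    flipMiddles-preservesMiddle (i , k , occ , pi , pk)
      with positive⇒nonMiddle-NorthWest pi | positive⇒nonMiddle-SouthEast pk
    ... | i* , i*↖i , pi* , ¬mi* | k* , k↖k* , pk* , ¬mk* =
      i* , k* , Is321-widen i*↖i k↖k* occ ,
      trans (flipMiddles-nonMiddle ¬mi*) pi* , trans (flipMiddles-nonMiddle ¬mk*) pk*

    flipMiddles-positive⇒positive-NorthWest : ∀ {i} → flipMiddles p i ≡ pos →
                                              ∃ λ i′ → NorthWest i′ i × p i′ ≡ pos
    flipMiddles-positive⇒positive-NorthWest {i} pi with middle? p i
    ... | no _ = i , NorthWest-refl , pi
    ... | yes (i′ , _ , (i′<i , _ , σi<σi′ , _) , pi′ , _) = i′ , (<⇒≤ i′<i , <⇒≤ σi<σi′) , pi′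

    flipMiddles-positive⇒positive-SouthEast : ∀ {k} → flipMiddles p k ≡ pos →
                                              ∃ λ k′ → NorthWest k k′ × p k′ ≡ pos
    flipMiddles-positive⇒positive-SouthEast {k} pk with middle? p k
    ... | no _ = k , NorthWest-refl , pk
    ... | yes (_ , k′ , (_ , k<k′ , _ , σk′<σk) , _ , pk′) = k′ , (<⇒≤ k<k′ , <⇒≤ σk′<σk) , pk′

    flipMiddles-reflectsMiddle : ∀ {j} → Middle (flipMiddles p) j → Middle p j
    flipMiddles-reflectsMiddle (i , k , occ , pi , pk)
      with flipMiddles-positive⇒positive-NorthWest pi | flipMiddles-positive⇒positive-SouthEast pk
    ... | i′ , i′↖i , pi′ | k′ , k↖k′ , pk′ = i′ , k′ , Is321-widen i′↖i k↖k′ occ , pi′ , pk′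

    flipMiddles-involutive : flipMiddles (flipMiddles p) ≗ p
    flipMiddles-involutive j = case middle? p j of λ where
      (yes m) → begin
        flipMiddles (flipMiddles p) j  ≡⟨ flipMiddles-middle (flipMiddles-preservesMiddle m) ⟩
        flipSign (flipMiddles p j)     ≡⟨ cong flipSign (flipMiddles-middle m) ⟩
        flipSign (flipSign (p j))      ≡⟨ flipSign-involutive (p j) ⟩
        p j                            ∎
      (no ¬m) → begin
        flipMiddles (flipMiddles p) j  ≡⟨ flipMiddles-nonMiddle (¬m ∘ flipMiddles-reflectsMiddle) ⟩
        flipMiddles p j                ≡⟨ flipMiddles-nonMiddle ¬m ⟩
        p j                            ∎

    module _ (σ-involutive : ∀ x → σ (σ x) ≡ x) (p-σ-invariant : ∀ x → p (σ x) ≡ p x) where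

      middle-involution : ∀ {j} → Middle p j → Middle p (σ j)
      middle-involution (i , k , occ , pi , pk) =
        σ k , σ i , Is321-involution σ-involutive occ ,
        trans (p-σ-invariant k) pk , trans (p-σ-invariant i) pi

      nonMiddle-involution : ∀ {j} → ¬ Middle p j → ¬ Middle p (σ j)
      nonMiddle-involution {j} ¬m = ¬m ∘ subst (Middle p) (σ-involutive j) ∘ middle-involution

      flipMiddles-σ-invariant : ∀ x → flipMiddles p (σ x) ≡ flipMiddles p x
      flipMiddles-σ-invariant x = case middle? p x of λ where
        (yes m) → begin
          flipMiddles p (σ x)  ≡⟨ flipMiddles-middle (middle-involution m) ⟩
          flipSign (p (σ x))   ≡⟨ cong flipSign (p-σ-invariant x) ⟩
          flipSign (p x)       ≡⟨ flipMiddles-middle m ⟨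
          flipMiddles p x      ∎
        (no ¬m) → begin
          flipMiddles p (σ x)  ≡⟨ flipMiddles-nonMiddle (nonMiddle-involution ¬m) ⟩
          p (σ x)              ≡⟨ p-σ-invariant x ⟩
          p x                  ≡⟨ flipMiddles-nonMiddle ¬m ⟨
          flipMiddles p x      ∎

middle-cong : ∀ {n} {σ σ′ : Fin n → Fin n} {p p′ : Fin n → Sign} → σ ≗ σ′ → p ≗ p′ →
              ∀ {j} → Middle σ p j → Middle σ′ p′ j
middle-cong σ≗σ′ p≗p′ {j} (i , k , (i<j , j<k , σj<σi , σk<σj) , pi , pk) =
  i , k , (i<j , j<k , subst₂ _<_ (σ≗σ′ j) (σ≗σ′ i) σj<σi , subst₂ _<_ (σ≗σ′ k) (σ≗σ′ j) σk<σj) ,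
  trans (sym (p≗p′ i)) pi , trans (sym (p≗p′ k)) pk

flipMiddles-cong : ∀ {n} {σ σ′ : Fin n → Fin n} {p p′ : Fin n → Sign} → σ ≗ σ′ → p ≗ p′ →
                   flipMiddles σ p ≗ flipMiddles σ′ p′
flipMiddles-cong {σ = σ} {σ′} {p} {p′} σ≗σ′ p≗p′ j = case middle? σ p j of λ where
  (yes m) → begin
    flipMiddles σ p j    ≡⟨ flipMiddles-middle σ m ⟩
    flipSign (p j)       ≡⟨ cong flipSign (p≗p′ j) ⟩
    flipSign (p′ j)      ≡⟨ flipMiddles-middle σ′ (middle-cong σ≗σ′ p≗p′ m) ⟨
    flipMiddles σ′ p′ j  ∎
  (no ¬m) → begin
    flipMiddles σ p j    ≡⟨ flipMiddles-nonMiddle σ ¬m ⟩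
    p j                  ≡⟨ p≗p′ j ⟩
    p′ j                 ≡⟨ flipMiddles-nonMiddle σ′ (¬m ∘ middle-cong (sym ∘ σ≗σ′) (sym ∘ p≗p′)) ⟨
    flipMiddles σ′ p′ j  ∎

module _ {n : ℕ} where

  abs : Word n → Fin n → Fin n
  abs w = ∣_∣ ∘ lookup w

  sgn : Word n → Fin n → Sign
  sgn w = sign ∘ lookup w

  flipMiddleSigns : Word n → Word n
  flipMiddleSigns w = tabulate λ x → flipMiddles (abs w) (sgn w) x , abs w x

  abs-flipMiddleSigns : ∀ w → abs (flipMiddleSigns w) ≗ abs w
  abs-flipMiddleSigns w = cong proj₂ ∘ lookup∘tabulate _

  sgn-flipMiddleSigns : ∀ w → sgn (flipMiddleSigns w) ≗ flipMiddles (abs w) (sgn w)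
  sgn-flipMiddleSigns w = cong proj₁ ∘ lookup∘tabulate _

  flipMiddleSigns-involutive : ∀ w → flipMiddleSigns (flipMiddleSigns w) ≡ w
  flipMiddleSigns-involutive w = trans (tabulate-cong letter) (tabulate∘lookup w)
    where
    w′ = flipMiddleSigns w
    letter : ∀ x → (flipMiddles (abs w′) (sgn w′) x , abs w′ x) ≡ lookup w x
    letter x = cong₂ _,_
      (trans (flipMiddles-cong (abs-flipMiddleSigns w) (sgn-flipMiddleSigns w) x)
             (flipMiddles-involutive (abs w) x))
      (abs-flipMiddleSigns w x)

  flipMiddleSigns-signedPerm : ∀ {w} → IsSignedPerm w → IsSignedPerm (flipMiddleSigns w)
  flipMiddleSigns-signedPerm {w} perm i j i≢j eq =
    perm i j i≢j (trans (sym (abs-flipMiddleSigns w i)) (trans eq (abs-flipMiddleSigns w j)))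

  flipMiddleSigns-involution : ∀ {w} → IsInvolution w → IsInvolution (flipMiddleSigns w)
  flipMiddleSigns-involution {w} inv i = abs-involutive , sgn-invariant
    where
    w′ = flipMiddleSigns w
    p′ = flipMiddles (abs w) (sgn w)
    abs-involutive : abs w′ (abs w′ i) ≡ i
    abs-involutive = begin
      abs w′ (abs w′ i)  ≡⟨ abs-flipMiddleSigns w (abs w′ i) ⟩
      abs w (abs w′ i)   ≡⟨ cong (abs w) (abs-flipMiddleSigns w i) ⟩
      abs w (abs w i)    ≡⟨ proj₁ (inv i) ⟩
      i                  ∎
    sgn-invariant : sgn w′ (abs w′ i) ≡ sgn w′ i
    sgn-invariant = begin
      sgn w′ (abs w′ i)  ≡⟨ sgn-flipMiddleSigns w (abs w′ i) ⟩
      p′ (abs w′ i)      ≡⟨ cong p′ (abs-flipMiddleSigns w i) ⟩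
      p′ (abs w i)       ≡⟨ flipMiddles-σ-invariant (abs w) (proj₁ ∘ inv) (proj₂ ∘ inv) i ⟩
      p′ i               ≡⟨ sgn-flipMiddleSigns w i ⟨
      sgn w′ i           ∎

p3s1 : Sign → Word 3
p3s1 s = (pos , suc (suc zero)) ∷ (s , suc zero) ∷ (pos , zero) ∷ []

module _ {n : ℕ} {w : Word n} {s : Sign} where

  contains-p3s1⇒middle : Contains w (p3s1 s) → ∃ λ j → Middle (abs w) (sgn w) j × sgn w j ≡ s
  contains-p3s1⇒middle (ι , increasing , matches) =
    ι (# 1) , (ι (# 0) , ι (# 2) ,
    (increasing (# 0) (# 1) (s≤s z≤n) , increasing (# 1) (# 2) (s≤s (s≤s z≤n)) ,
     Equivalence.from (proj₁ (matches (# 1) (# 0))) (s≤s (s≤s z≤n)) ,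
     Equivalence.from (proj₁ (matches (# 2) (# 1))) (s≤s z≤n)) ,
     proj₂ (matches (# 0) (# 0)) , proj₂ (matches (# 2) (# 2))) , proj₂ (matches (# 1) (# 1))

  middle⇒contains-p3s1 : ∀ {j} → Middle (abs w) (sgn w) j → sgn w j ≡ s → Contains w (p3s1 s)
  middle⇒contains-p3s1 {j} (i , k , (i<j , j<k , σj<σi , σk<σj) , pi , pk) pj =
    ι , monotone-Fin3 {R = _<_} <-trans ι i<j j<k , λ x y → orderIsomorphic x y , signs x
    where
    ι : Fin 3 → Fin n
    ι = lookup (i ∷ j ∷ k ∷ [])

    ι-decreasing : ∀ x y → x < y → abs w (ι x) > abs w (ι y)
    ι-decreasing = monotone-Fin3 {R = _>_} (flip <-trans) (abs w ∘ ι) σj<σi σk<σj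

    pattern-decreasing : ∀ x y → x < y → ∣ lookup (p3s1 s) x ∣ > ∣ lookup (p3s1 s) y ∣
    pattern-decreasing =
      monotone-Fin3 {R = _>_} (flip <-trans) (∣_∣ ∘ lookup (p3s1 s)) (s≤s (s≤s z≤n)) (s≤s z≤n)

    orderIsomorphic : ∀ x y →
      (abs w (ι x) < abs w (ι y)) ⇔ (∣ lookup (p3s1 s) x ∣ < ∣ lookup (p3s1 s) y ∣)
    orderIsomorphic x y = ⇔.trans (strictlyDecreasing⇒<⇔> ι-decreasing x y)
                                  (⇔.sym (strictlyDecreasing⇒<⇔> pattern-decreasing x y))

    signs : ∀ x → sgn w (ι x) ≡ sign (lookup (p3s1 s) x)
    signs zero = pi
    signs (suc zero) = pj
    signs (suc (suc zero)) = pk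

flipMiddleSigns-avoids : ∀ {n} {w : Word n} {s} →
                         Avoids w (p3s1 s) → Avoids (flipMiddleSigns w) (p3s1 (flipSign s))
flipMiddleSigns-avoids {w = w} {s} avoids contains
  with contains-p3s1⇒middle {w = flipMiddleSigns w} contains
... | j , middle′ , j-sign = avoids (middle⇒contains-p3s1 {w = w} middle (flipSign-injective flipped))
  where
  middle : Middle (abs w) (sgn w) j
  middle = flipMiddles-reflectsMiddle (abs w)
    (middle-cong (abs-flipMiddleSigns w) (sgn-flipMiddleSigns w) middle′)
  flipped : flipSign (sgn w j) ≡ flipSign s
  flipped = begin
    flipSign (sgn w j)             ≡⟨ flipMiddles-middle (abs w) middle ⟨
    flipMiddles (abs w) (sgn w) j  ≡⟨ sgn-flipMiddleSigns w j ⟨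
    sgn (flipMiddleSigns w) j      ≡⟨ j-sign ⟩
    flipSign s                     ∎

SI-flipMiddleSigns : ∀ {n s} → SI n (p3s1 s) → SI n (p3s1 (flipSign s))
SI-flipMiddleSigns (mkSI w perm inv avoids) =
  mkSI (flipMiddleSigns w) (flipMiddleSigns-signedPerm {w = w} perm)
       (flipMiddleSigns-involution {w = w} inv) (flipMiddleSigns-avoids {w = w} avoids)

SI-word-injective : ∀ {n k} {τ : Word k} {π ρ : SI n τ} → SI.word π ≡ SI.word ρ → π ≡ ρ
SI-word-injective {π = mkSI w _ _ _} {mkSI .w _ _ _} refl = refl

proposition3p1 : (n : ℕ) → n ≥ 1 → SI n p321 ↔ SI n p3b21
proposition3p1 n _ = mk↔ₛ′ SI-flipMiddleSigns SI-flipMiddleSigns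
  (λ π → SI-word-injective (flipMiddleSigns-involutive (SI.word π)))
  (λ π → SI-word-injective (flipMiddleSigns-involutive (SI.word π)))
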